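{- Let $k\geq1$ and let $T\subset\mathbb{R}^{k+1}$ be the set of points satisfying all type $0$ and type $1$–$4$ inequalities (defined below). Then the extremal rays of $T$ are $v_1,\dots,v_k,w_1,\dots,w_k$, where $v_j$ is the $j$-th standard basis vector of $\mathbb{R}^{k+1}$ and $w_j=v_{k+1}-v_j$.
   Context: Coordinates are $(x_1,\dots,x_k,z)$. A type $0$, level $\ell$ inequality ($0\leq\ell\leq k$) is $x_{j_1}+\dots+x_{j_\ell}+z\geq\frac{1+\ell}{2}$ for pairwise distinct $j_1,\dots,j_\ell\in\{1,\dots,k\}$. A type $t$, level $\ell$ inequality ($1\leq t\leq 4$, $0\leq\ell\leq k-t$) is $x_{i_1}+\dots+x_{i_t}+2x_{j_1}+\dots+2x_{j_\ell}+2z\geq 1+\frac{3t}{4}+\ell$ for pairwise distinct indices $i_1,\dots,i_t,j_1,\dots,j_\ell$. The extremal rays of a polyhedron $\{x:Mx\geq b\}$ are (up to positive scaling) the extremal rays of the cone $\{x:Mx\geq0\}$, i.e. the nonzero vectors of this cone that cannot be written as a sum of two non-proportional vectors of the cone.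
   Formalization: Points are taken in ℚ^(k+1) instead of $\mathbb{R}^{k+1}$, so the set T, the cone $\{x:Mx\geq0\}$ and the two summands in the definition of an extremal ray are rational vectors. -}

module Defs where

open import Data.Nat as ℕ using (ℕ; zero; suc)
open import Data.Integer using (+_)
open import Data.Rational using (ℚ; 0ℚ; 1ℚ; _+_; _*_; -_; _≤_; _<_; _/_)
open import Data.Fin using (Fin; zero; suc; _≟_)
open import Data.Fin.Subset using (Subset; _∈_; ∣_∣)
open import Data.Vec using (lookup)
open import Data.Bool using (Bool; true; false; if_then_else_)
open import Data.Product using (_×_; _,_; Σ; ∃; ∃-syntax)
open import Data.Sum using (_⊎_)
open import Relation.Nullary using (¬_; does)
open import Relation.Binary.PropositionalEquality using (_≡_)

-- Points of ℝ^{k+1} (here ℚ^{k+1}) with coordinates (x₁,…,x_k,z),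
-- represented as a pair (x , z) with x : Fin k → ℚ.
Point : ℕ → Set
Point k = (Fin k → ℚ) × ℚ

Σᶠ : ∀ {k} → (Fin k → ℚ) → ℚ
Σᶠ {zero}  f = 0ℚ
Σᶠ {suc k} f = f zero + Σᶠ (λ i → f (suc i))

-- A linear inequality  a·x + c·z ≥ b  on Point k.
record Ineq (k : ℕ) : Set where
  constructor ineq
  field
    coeffX : Fin k → ℚ
    coeffZ : ℚ
    rhs    : ℚ
open Ineq public

lhs : ∀ {k} → Ineq k → Point k → ℚ
lhs (ineq a c b) (x , z) = Σᶠ (λ i → a i * x i) + c * z

𝟙 : ∀ {k} → Subset k → Fin k → ℚ
𝟙 J i = if lookup J i then 1ℚ else 0ℚ

Disjoint : ∀ {k} → Subset k → Subset k → Set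
Disjoint I J = ∀ i → ¬ (i ∈ I × i ∈ J)

-- Type 0, level ℓ = ∣J∣:  Σ_{j∈J} x_j + z ≥ (1+ℓ)/2
-- (a set J of pairwise distinct indices j₁,…,j_ℓ; the sum is symmetric).
type0 : ∀ {k} → Subset k → Ineq k
type0 J = ineq (𝟙 J) 1ℚ ((+ (1 ℕ.+ ∣ J ∣)) / 2)

-- Type t, level ℓ = ∣J∣, with ∣I∣ = t and I, J disjoint:
--   Σ_{i∈I} x_i + 2 Σ_{j∈J} x_j + 2z ≥ 1 + 3t/4 + ℓ = (4 + 3t + 4ℓ)/4
typeT : ∀ {k} → Subset k → Subset k → Ineq k
typeT I J = ineq (λ i → 𝟙 I i + (+ 2 / 1) * 𝟙 J i) (+ 2 / 1)
                 ((+ (4 ℕ.+ 3 ℕ.* ∣ I ∣ ℕ.+ 4 ℕ.* ∣ J ∣)) / 4)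

data IsDefiningIneq (k : ℕ) : Ineq k → Set where
  ty0 : (J : Subset k) → IsDefiningIneq k (type0 J)
  tyT : (I J : Subset k) → 1 ℕ.≤ ∣ I ∣ → ∣ I ∣ ℕ.≤ 4 → Disjoint I J →
        IsDefiningIneq k (typeT I J)

T : (k : ℕ) → Point k → Set
T k p = ∀ e → IsDefiningIneq k e → rhs e ≤ lhs e p

-- Its recession cone {p : M p ≥ 0}; extremal rays of T are those of this cone.
Cone : (k : ℕ) → Point k → Set
Cone k p = ∀ e → IsDefiningIneq k e → 0ℚ ≤ lhs e p

_≈ₚ_ : ∀ {k} → Point k → Point k → Set
(x , z) ≈ₚ (y , w) = (∀ i → x i ≡ y i) × z ≡ w

_+ₚ_ : ∀ {k} → Point k → Point k → Point k
(x , z) +ₚ (y , w) = (λ i → x i + y i) , z + w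

_·ₚ_ : ∀ {k} → ℚ → Point k → Point k
c ·ₚ (x , z) = (λ i → c * x i) , c * z

0ₚ : ∀ {k} → Point k
0ₚ = (λ _ → 0ℚ) , 0ℚ

Proportional : ∀ {k} → Point k → Point k → Set
Proportional u w = (∃[ c ] u ≈ₚ (c ·ₚ w)) ⊎ (∃[ c ] w ≈ₚ (c ·ₚ u))

IsExtremalRay : ∀ {k} → (Point k → Set) → Point k → Set
IsExtremalRay C r =
  C r × ¬ (r ≈ₚ 0ₚ) ×
  ¬ (∃[ u ] ∃[ w ] (C u × C w × r ≈ₚ (u +ₚ w) × ¬ Proportional u w))

IsExtremalRayOfT : (k : ℕ) → Point k → Set
IsExtremalRayOfT k = IsExtremalRay (Cone k)

δ : ∀ {k} → Fin k → Fin k → ℚ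
δ j i = if does (i ≟ j) then 1ℚ else 0ℚ

v : ∀ {k} → Fin k → Point k
v j = δ j , 0ℚ

w : ∀ {k} → Fin k → Point k
w j = (λ i → - δ j i) , 1ℚ

{-# OPTIONS --safe #-}
module Submission where

-- Every defining inequality has coefficients 0 ≤ aₗ ≤ c on xₗ and z, and the type 0 inequality for J = {l : xₗ < 0} reads
-- z ≥ Σₗ max(0, −xₗ). So the recession cone is {(x, z) : deficit x ≤ z} with
-- deficit x = Σₗ max(0, −xₗ).
-- If xᵢ ≠ 0, an extremal ray r = (x, z) splits inside this cone as
-- (xᵢ eᵢ, max(0, −xᵢ)) + (x − xᵢ eᵢ, z − max(0, −xᵢ)), whose second summand vanishes at i, so r
-- is the first summand: a positive multiple of vᵢ or wᵢ. x = 0 is impossible, since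
-- (0, z) = z v₁ + z w₁. Conversely, the inequalities for J = ∅ and J = {l} (l ≠ j) are tight at
-- vⱼ, and those for J = {j} and J = {j, l} at wⱼ; an inequality that is tight at a sum of cone
-- points is tight at each summand, which forces both summands onto the same ray.

open import Defs

module RecessionConeOfT where

  open import Data.Nat using (ℕ; zero; suc)
  import Data.Integer as ℤ
  open import Data.Rational
    using (ℚ; 0ℚ; 1ℚ; _+_; _*_; -_; _-_; _≤_; _<_; _⊔_; _/_; 1/_; _≤?_; _<?_; nonNegative; ≢-nonZero)
  open import Data.Rational.Properties hiding (_≟_)
  open import Data.Rational.Properties using () renaming (_≟_ to _≟ℚ_)
  open import Data.Fin using (Fin; zero; suc; _≟_)
  open import Data.Fin.Properties using (suc-injective; all?; ¬∀⟶∃¬)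
  open import Data.Fin.Subset using (Subset)
  open import Data.Vec using (lookup; tabulate)
  open import Data.Vec.Properties using (lookup∘tabulate; lookup⇒[]=)
  open import Data.Bool using (true; false; if_then_else_)
  open import Data.Product using (_×_; _,_; proj₁; proj₂; ∃-syntax)
  open import Data.Sum using (_⊎_; inj₁; inj₂)
  open import Data.Empty using (⊥-elim)
  open import Function.Base using (_∘_)
  open import Relation.Binary.Definitions using (tri<; tri≈; tri>)
  open import Relation.Nullary using (¬_; Dec; yes; no; does; contradiction)
  open import Relation.Nullary.Decidable using (toWitness; decidable-stable; dec⇒maybe)
  open import Relation.Binary.PropositionalEquality
  open import Algebra.Bundles using (CommutativeMonoid)
  open import Algebra.Properties.Group +-0-group using (⁻¹-involutive; inverseʳ-unique)
  open import Algebra.Properties.CommutativeSemigroup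
    (CommutativeMonoid.commutativeSemigroup +-0-commutativeMonoid) using (interchange)
  open import Tactic.RingSolver using (solve-∀)
  open import Tactic.RingSolver.Core.AlmostCommutativeRing
    using (AlmostCommutativeRing; fromCommutativeRing)

  private
    variable
      k : ℕ
      p q r c : ℚ
      j l : Fin k

  ℚ-ring : AlmostCommutativeRing _ _
  ℚ-ring = fromCommutativeRing +-*-commutativeRing (λ x → dec⇒maybe (0ℚ ≟ℚ x))

  0≤p*q : 0ℚ ≤ p → 0ℚ ≤ q → 0ℚ ≤ p * q
  0≤p*q {p} {q} 0≤p 0≤q =
    nonNegative⁻¹ (p * q) {{nonNeg*nonNeg⇒nonNeg p {{nonNegative 0≤p}} q {{nonNegative 0≤q}}}}

  p≤q⇒0≤q-p : p ≤ q → 0ℚ ≤ q - p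
  p≤q⇒0≤q-p {p} {q} p≤q = subst (_≤ q - p) (+-inverseʳ p) (+-monoˡ-≤ (- p) p≤q)

  p+q≤r⇒p≤r-q : p + q ≤ r → p ≤ r - q
  p+q≤r⇒p≤r-q {p} {q} {r} p+q≤r = subst (_≤ r - q) (p+q-q≡p p q) (+-monoˡ-≤ (- q) p+q≤r)
    where
    p+q-q≡p : ∀ p q → p + q - q ≡ p
    p+q-q≡p = solve-∀ ℚ-ring

  0≤q-p⇒p≤q : ∀ {p q} → 0ℚ ≤ q - p → p ≤ q
  0≤q-p⇒p≤q {p} {q} 0≤q-p = subst₂ _≤_ (+-identityˡ p) (q-p+p≡q q p) (+-monoˡ-≤ p 0≤q-p)
    where
    q-p+p≡q : ∀ q p → q - p + p ≡ q
    q-p+p≡q = solve-∀ ℚ-ring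

  -p≤q⇒0≤q+p : - p ≤ q → 0ℚ ≤ q + p
  -p≤q⇒0≤q+p {p} {q} -p≤q = subst (_≤ q + p) (+-inverseˡ p) (+-monoˡ-≤ p -p≤q)

  nonNeg+nonNeg≡0⇒≡0 : 0ℚ ≤ p → 0ℚ ≤ q → p + q ≡ 0ℚ → p ≡ 0ℚ
  nonNeg+nonNeg≡0⇒≡0 {p} {q} 0≤p 0≤q p+q≡0 =
    ≤-antisym (subst₂ _≤_ (+-identityʳ p) p+q≡0 (+-monoʳ-≤ p 0≤q)) 0≤p

  p*q≡0⇒p≡0 : ∀ {p q} → q ≢ 0ℚ → p * q ≡ 0ℚ → p ≡ 0ℚ
  p*q≡0⇒p≡0 {p} {q} q≢0 pq≡0 = begin
    p              ≡⟨ *-identityʳ p ⟨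
    p * 1ℚ         ≡⟨ cong (p *_) (*-inverseʳ q) ⟨
    p * (q * 1/ q) ≡⟨ *-assoc p q (1/ q) ⟨
    p * q * 1/ q   ≡⟨ cong (_* 1/ q) pq≡0 ⟩
    0ℚ * 1/ q      ≡⟨ *-zeroˡ (1/ q) ⟩
    0ℚ             ∎
    where
    open ≡-Reasoning
    instance _ = ≢-nonZero q≢0

  infix 8 _⁻

  _⁻ : ℚ → ℚ
  p ⁻ = 0ℚ ⊔ - p

  0≤p⁻ : ∀ p → 0ℚ ≤ p ⁻
  0≤p⁻ p = p≤p⊔q 0ℚ (- p)

  -p≤p⁻ : ∀ p → - p ≤ p ⁻
  -p≤p⁻ p = p≤q⊔p 0ℚ (- p)

  0≤p⇒p⁻≡0 : 0ℚ ≤ p → p ⁻ ≡ 0ℚ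
  0≤p⇒p⁻≡0 0≤p = p≥q⇒p⊔q≡p (neg-antimono-≤ 0≤p)

  p≤0⇒p⁻≡-p : p ≤ 0ℚ → p ⁻ ≡ - p
  p≤0⇒p⁻≡-p p≤0 = p≤q⇒p⊔q≡q (neg-antimono-≤ p≤0)

  0≤a*p+c*p⁻ : ∀ {a} → 0ℚ ≤ a → a ≤ c → ∀ p → 0ℚ ≤ a * p + c * p ⁻
  0≤a*p+c*p⁻ {c = c} {a} 0≤a a≤c p with ≤-total 0ℚ p
  ... | inj₁ 0≤p rewrite 0≤p⇒p⁻≡0 0≤p | *-zeroʳ c | +-identityʳ (a * p) = 0≤p*q 0≤a 0≤p
  ... | inj₂ p≤0 rewrite p≤0⇒p⁻≡-p p≤0 =
    subst (0ℚ ≤_) (factor a c p) (0≤p*q (p≤q⇒0≤q-p a≤c) (neg-antimono-≤ p≤0))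
    where
    factor : ∀ a c p → (c - a) * - p ≡ a * p + c * - p
    factor = solve-∀ ℚ-ring

  Σᶠ-cong : ∀ {f g : Fin k → ℚ} → (∀ i → f i ≡ g i) → Σᶠ f ≡ Σᶠ g
  Σᶠ-cong {zero}  f≗g = refl
  Σᶠ-cong {suc k} f≗g = cong₂ _+_ (f≗g zero) (Σᶠ-cong (f≗g ∘ suc))

  Σᶠ-0 : Σᶠ {k} (λ _ → 0ℚ) ≡ 0ℚ
  Σᶠ-0 {zero}  = refl
  Σᶠ-0 {suc k} = cong (0ℚ +_) (Σᶠ-0 {k})

  Σᶠ-+ : ∀ (f g : Fin k → ℚ) → Σᶠ (λ i → f i + g i) ≡ Σᶠ f + Σᶠ g
  Σᶠ-+ {zero}  f g = refl
  Σᶠ-+ {suc k} f g = begin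
    f zero + g zero + Σᶠ (λ i → f (suc i) + g (suc i))
      ≡⟨ cong (f zero + g zero +_) (Σᶠ-+ (f ∘ suc) (g ∘ suc)) ⟩
    f zero + g zero + (Σᶠ (f ∘ suc) + Σᶠ (g ∘ suc))
      ≡⟨ interchange (f zero) (g zero) _ _ ⟩
    f zero + Σᶠ (f ∘ suc) + (g zero + Σᶠ (g ∘ suc))
      ∎
    where open ≡-Reasoning

  Σᶠ-* : ∀ c (f : Fin k → ℚ) → Σᶠ (λ i → c * f i) ≡ c * Σᶠ f
  Σᶠ-* {zero}  c f = sym (*-zeroʳ c)
  Σᶠ-* {suc k} c f =
    trans (cong (c * f zero +_) (Σᶠ-* c (f ∘ suc))) (sym (*-distribˡ-+ c (f zero) _))

  Σᶠ-neg : ∀ (f : Fin k → ℚ) → Σᶠ (λ i → - f i) ≡ - Σᶠ f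
  Σᶠ-neg {zero}  f = refl
  Σᶠ-neg {suc k} f =
    trans (cong (- f zero +_) (Σᶠ-neg (f ∘ suc))) (sym (neg-distrib-+ (f zero) _))

  Σᶠ-mono-≤ : ∀ {f g : Fin k → ℚ} → (∀ i → f i ≤ g i) → Σᶠ f ≤ Σᶠ g
  Σᶠ-mono-≤ {zero}  f≤g = ≤-refl
  Σᶠ-mono-≤ {suc k} f≤g = +-mono-≤ (f≤g zero) (Σᶠ-mono-≤ (f≤g ∘ suc))

  Σᶠ-nonNeg : ∀ {f : Fin k → ℚ} → (∀ i → 0ℚ ≤ f i) → 0ℚ ≤ Σᶠ f
  Σᶠ-nonNeg {k} {f} 0≤f = subst (_≤ Σᶠ f) (Σᶠ-0 {k}) (Σᶠ-mono-≤ 0≤f)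

  Σᶠ-update : (f g : Fin k → ℚ) (i : Fin k) → (∀ l → l ≢ i → f l ≡ g l) →
              Σᶠ f + g i ≡ Σᶠ g + f i
  Σᶠ-update {suc k} f g zero f≗g = begin
    f zero + Σᶠ (f ∘ suc) + g zero  ≡⟨ cong (λ s → f zero + s + g zero) (Σᶠ-cong λ l → f≗g (suc l) λ ()) ⟩
    f zero + Σᶠ (g ∘ suc) + g zero  ≡⟨ swap (f zero) _ (g zero) ⟩
    g zero + Σᶠ (g ∘ suc) + f zero  ∎
    where
    open ≡-Reasoning
    swap : ∀ a s b → a + s + b ≡ b + s + a
    swap = solve-∀ ℚ-ring
  Σᶠ-update {suc k} f g (suc i) f≗g = begin
    f zero + Σᶠ (f ∘ suc) + g (suc i)    ≡⟨ +-assoc (f zero) _ _ ⟩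
    f zero + (Σᶠ (f ∘ suc) + g (suc i))  ≡⟨ cong₂ _+_ (f≗g zero λ ()) (Σᶠ-update (f ∘ suc) (g ∘ suc) i
                                                 λ l l≢i → f≗g (suc l) (l≢i ∘ suc-injective)) ⟩
    g zero + (Σᶠ (g ∘ suc) + f (suc i))  ≡⟨ +-assoc (g zero) _ _ ⟨
    g zero + Σᶠ (g ∘ suc) + f (suc i)    ∎
    where open ≡-Reasoning

  Σᶠ-≥-single : ∀ {f : Fin k → ℚ} → (∀ l → 0ℚ ≤ f l) → ∀ i → f i ≤ Σᶠ f
  Σᶠ-≥-single {suc k} {f} 0≤f zero =
    subst (_≤ Σᶠ f) (+-identityʳ (f zero)) (+-monoʳ-≤ (f zero) (Σᶠ-nonNeg (0≤f ∘ suc)))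
  Σᶠ-≥-single {suc k} {f} 0≤f (suc i) =
    subst (_≤ Σᶠ f) (+-identityˡ (f (suc i))) (+-mono-≤ (0≤f zero) (Σᶠ-≥-single (0≤f ∘ suc) i))

  Σᶠ-≥-pair : ∀ {f : Fin k → ℚ} → (∀ l → 0ℚ ≤ f l) → ∀ {i l} → i ≢ l → f i + f l ≤ Σᶠ f
  Σᶠ-≥-pair {suc k} {f} 0≤f {zero}  {zero}  i≢l = contradiction refl i≢l
  Σᶠ-≥-pair {suc k} {f} 0≤f {zero}  {suc l} i≢l =
    +-monoʳ-≤ (f zero) (Σᶠ-≥-single (0≤f ∘ suc) l)
  Σᶠ-≥-pair {suc k} {f} 0≤f {suc i} {zero}  i≢l =
    subst (_≤ Σᶠ f) (+-comm (f zero) (f (suc i)))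
          (+-monoʳ-≤ (f zero) (Σᶠ-≥-single (0≤f ∘ suc) i))
  Σᶠ-≥-pair {suc k} {f} 0≤f {suc i} {suc l} i≢l =
    subst (_≤ Σᶠ f) (+-identityˡ _)
          (+-mono-≤ (0≤f zero) (Σᶠ-≥-pair (0≤f ∘ suc) (i≢l ∘ cong suc)))

  deficit : (Fin k → ℚ) → ℚ
  deficit x = Σᶠ (λ i → x i ⁻)

  -- A record rather than the bare inequality, so that p can be inferred from a proof.
  record DeficitCone (p : Point k) : Set where
    constructor bounded
    field
      deficit≤z : deficit (proj₁ p) ≤ proj₂ p

  lhs-nonNeg : (e : Ineq k) → 0ℚ ≤ coeffZ e →
               (∀ l → 0ℚ ≤ coeffX e l × coeffX e l ≤ coeffZ e) →
               ∀ {p} → DeficitCone p → 0ℚ ≤ lhs e p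
  lhs-nonNeg (ineq a c _) 0≤c a∈[0,c] {x , z} (bounded deficit≤z) = begin
    0ℚ                                ≤⟨ Σᶠ-nonNeg termwise ⟩
    Σᶠ (λ l → a l * x l + c * x l ⁻)  ≡⟨ Σᶠ-+ (λ l → a l * x l) (λ l → c * x l ⁻) ⟩
    ax + Σᶠ (λ l → c * x l ⁻)         ≡⟨ cong (ax +_) (Σᶠ-* c (λ l → x l ⁻)) ⟩
    ax + c * deficit x                ≤⟨ +-monoʳ-≤ ax (*-monoˡ-≤-nonNeg c {{nonNegative 0≤c}} deficit≤z) ⟩
    ax + c * z                        ∎
    where
    open ≤-Reasoning
    ax : ℚ
    ax = Σᶠ (λ l → a l * x l)
    termwise : ∀ l → 0ℚ ≤ a l * x l + c * x l ⁻
    termwise l = 0≤a*p+c*p⁻ (proj₁ (a∈[0,c] l)) (proj₂ (a∈[0,c] l)) (x l)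

  𝟙-bounds : ∀ (J : Subset k) l → 0ℚ ≤ 𝟙 J l × 𝟙 J l ≤ 1ℚ
  𝟙-bounds J l with lookup J l
  ... | true  = toWitness {a? = 0ℚ ≤? 1ℚ} _ , ≤-refl
  ... | false = ≤-refl , toWitness {a? = 0ℚ ≤? 1ℚ} _

  typeT-coeff-bounds : ∀ (I J : Subset k) → Disjoint I J → ∀ l →
    0ℚ ≤ 𝟙 I l + (ℤ.+ 2 / 1) * 𝟙 J l × 𝟙 I l + (ℤ.+ 2 / 1) * 𝟙 J l ≤ ℤ.+ 2 / 1
  typeT-coeff-bounds I J I∩J=∅ l with lookup I l in l∈I | lookup J l in l∈J
  ... | true  | true  = contradiction (lookup⇒[]= l I l∈I , lookup⇒[]= l J l∈J) (I∩J=∅ l)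
  ... | true  | false = toWitness {a? = _ ≤? _} _ , toWitness {a? = _ ≤? _} _
  ... | false | true  = toWitness {a? = _ ≤? _} _ , toWitness {a? = _ ≤? _} _
  ... | false | false = toWitness {a? = _ ≤? _} _ , toWitness {a? = _ ≤? _} _

  DeficitCone⇒Cone : ∀ {p : Point k} → DeficitCone p → Cone k p
  DeficitCone⇒Cone d .(type0 J) (ty0 J) =
    lhs-nonNeg (type0 J) (toWitness {a? = 0ℚ ≤? 1ℚ} _) (𝟙-bounds J) d
  DeficitCone⇒Cone d .(typeT I J) (tyT I J _ _ I∩J=∅) =
    lhs-nonNeg (typeT I J) (toWitness {a? = 0ℚ ≤? _} _) (typeT-coeff-bounds I J I∩J=∅) d

  negativeSupport : (Fin k → ℚ) → Subset k
  negativeSupport x = tabulate (λ l → does (x l <? 0ℚ))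

  𝟙-negativeSupport : ∀ (x : Fin k → ℚ) l → 𝟙 (negativeSupport x) l * x l ≡ - (x l ⁻)
  𝟙-negativeSupport x l =
    trans (cong (λ b → (if b then 1ℚ else 0ℚ) * x l) (lookup∘tabulate (λ m → does (x m <? 0ℚ)) l))
          (indicator (x l) (x l <? 0ℚ))
    where
    indicator : ∀ q (q<?0 : Dec (q < 0ℚ)) → (if does q<?0 then 1ℚ else 0ℚ) * q ≡ - (q ⁻)
    indicator q (yes q<0) =
      trans (*-identityˡ q) (sym (trans (cong -_ (p≤0⇒p⁻≡-p (<⇒≤ q<0))) (⁻¹-involutive q)))
    indicator q (no q≮0) = trans (*-zeroˡ q) (sym (cong -_ (0≤p⇒p⁻≡0 (≮⇒≥ q≮0))))

  Cone⇒DeficitCone : ∀ {p : Point k} → Cone k p → DeficitCone p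
  Cone⇒DeficitCone {p = x , z} cone =
    bounded (0≤q-p⇒p≤q (subst (0ℚ ≤_) lhs≡z-deficit (cone _ (ty0 (negativeSupport x)))))
    where
    lhs≡z-deficit : lhs (type0 (negativeSupport x)) (x , z) ≡ z - deficit x
    lhs≡z-deficit = begin
      Σᶠ (λ l → 𝟙 (negativeSupport x) l * x l) + 1ℚ * z  ≡⟨ cong (_+ 1ℚ * z) (Σᶠ-cong (𝟙-negativeSupport x)) ⟩
      Σᶠ (λ l → - (x l ⁻)) + 1ℚ * z                      ≡⟨ cong (_+ 1ℚ * z) (Σᶠ-neg (λ l → x l ⁻)) ⟩
      - deficit x + 1ℚ * z                               ≡⟨ reorder (deficit x) z ⟩
      z - deficit x                                      ∎
      where
      open ≡-Reasoning
      reorder : ∀ d z → - d + 1ℚ * z ≡ z - d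
      reorder = solve-∀ ℚ-ring

  deficit-nonNeg : ∀ (x : Fin k → ℚ) → 0ℚ ≤ deficit x
  deficit-nonNeg x = Σᶠ-nonNeg (λ l → 0≤p⁻ (x l))

  DeficitCone⇒0≤z : ∀ {x : Fin k → ℚ} {z} → DeficitCone (x , z) → 0ℚ ≤ z
  DeficitCone⇒0≤z {x = x} (bounded deficit≤z) = ≤-trans (deficit-nonNeg x) deficit≤z

  DeficitCone⇒0≤z+xᵢ : ∀ {x : Fin k → ℚ} {z} → DeficitCone (x , z) → ∀ i → 0ℚ ≤ z + x i
  DeficitCone⇒0≤z+xᵢ {x = x} (bounded deficit≤z) i = -p≤q⇒0≤q+p (begin
    - x i       ≤⟨ -p≤p⁻ (x i) ⟩
    x i ⁻       ≤⟨ Σᶠ-≥-single (λ l → 0≤p⁻ (x l)) i ⟩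
    deficit x   ≤⟨ deficit≤z ⟩
    _           ∎)
    where open ≤-Reasoning

  DeficitCone⇒0≤z+xᵢ+xₗ : ∀ {x : Fin k → ℚ} {z} → DeficitCone (x , z) →
                          ∀ {i l} → i ≢ l → 0ℚ ≤ z + x i + x l
  DeficitCone⇒0≤z+xᵢ+xₗ {x = x} {z} (bounded deficit≤z) {i} {l} i≢l =
    subst (0ℚ ≤_) (sym (+-assoc z (x i) (x l))) (-p≤q⇒0≤q+p (begin
      - (x i + x l)    ≡⟨ neg-distrib-+ (x i) (x l) ⟩
      - x i + - x l    ≤⟨ +-mono-≤ (-p≤p⁻ (x i)) (-p≤p⁻ (x l)) ⟩
      x i ⁻ + x l ⁻    ≤⟨ Σᶠ-≥-pair (λ m → 0≤p⁻ (x m)) i≢l ⟩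
      deficit x        ≤⟨ deficit≤z ⟩
      z                ∎))
    where open ≤-Reasoning

  DeficitCone-resp-≈ₚ : ∀ {p q : Point k} → p ≈ₚ q → DeficitCone p → DeficitCone q
  DeficitCone-resp-≈ₚ (x≗y , z≡w) (bounded deficit≤z) =
    bounded (subst₂ _≤_ (Σᶠ-cong (λ l → cong _⁻ (x≗y l))) z≡w deficit≤z)

  ≈ₚ-sym : ∀ {p q : Point k} → p ≈ₚ q → q ≈ₚ p
  ≈ₚ-sym (x≗y , z≡w) = (λ l → sym (x≗y l)) , sym z≡w

  ≈ₚ-trans : ∀ {p q r : Point k} → p ≈ₚ q → q ≈ₚ r → p ≈ₚ r
  ≈ₚ-trans (x≗y , z≡w) (y≗y′ , w≡w′) = (λ l → trans (x≗y l) (y≗y′ l)) , trans z≡w w≡w′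

  ≈ₚ-stable : ∀ {p q : Point k} → ¬ ¬ (p ≈ₚ q) → p ≈ₚ q
  ≈ₚ-stable ¬¬p≈q =
    (λ l → decidable-stable (_ ≟ℚ _) (λ x≢y → ¬¬p≈q (λ p≈q → x≢y (proj₁ p≈q l)))) ,
    decidable-stable (_ ≟ℚ _) (λ z≢w → ¬¬p≈q (λ p≈q → z≢w (proj₂ p≈q)))

  +ₚ-comm : (p q : Point k) → (p +ₚ q) ≈ₚ (q +ₚ p)
  +ₚ-comm (x , z) (y , w) = (λ l → +-comm (x l) (y l)) , +-comm z w

  δ-diag : ∀ (j : Fin k) → δ j j ≡ 1ℚ
  δ-diag j with j ≟ j
  ... | yes _   = refl
  ... | no j≢j = contradiction refl j≢j

  δ-offDiag : l ≢ j → δ j l ≡ 0ℚ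
  δ-offDiag {l = l} {j} l≢j with l ≟ j
  ... | yes l≡j = contradiction l≡j l≢j
  ... | no _    = refl

  axis : Fin k → ℚ → Point k
  axis i a = (λ l → a * δ i l) , a ⁻

  axis≈v : ∀ (j : Fin k) {a} → 0ℚ ≤ a → axis j a ≈ₚ (a ·ₚ v j)
  axis≈v j {a} 0≤a = (λ _ → refl) , trans (0≤p⇒p⁻≡0 0≤a) (sym (*-zeroʳ a))

  axis≈w : ∀ (j : Fin k) {a} → a ≤ 0ℚ → axis j a ≈ₚ ((- a) ·ₚ w j)
  axis≈w j {a} a≤0 = (λ l → neg-cancel a (δ j l)) , trans (p≤0⇒p⁻≡-p a≤0) (sym (*-identityʳ (- a)))
    where
    neg-cancel : ∀ a d → a * d ≡ - a * - d
    neg-cancel = solve-∀ ℚ-ring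

  deficit-axis : ∀ (i : Fin k) a → deficit (proj₁ (axis i a)) ≡ a ⁻
  deficit-axis {k} i a = begin
    deficit (proj₁ (axis i a))                  ≡⟨ +-identityʳ _ ⟨
    deficit (proj₁ (axis i a)) + 0ℚ             ≡⟨ Σᶠ-update _ (λ _ → 0ℚ) i vanishes-off-i ⟩
    Σᶠ {k} (λ _ → 0ℚ) + (a * δ i i) ⁻           ≡⟨ cong₂ _+_ (Σᶠ-0 {k}) (cong (λ d → (a * d) ⁻) (δ-diag i)) ⟩
    0ℚ + (a * 1ℚ) ⁻                             ≡⟨ trans (+-identityˡ _) (cong _⁻ (*-identityʳ a)) ⟩
    a ⁻                                         ∎
    where
    open ≡-Reasoning
    vanishes-off-i : ∀ l → l ≢ i → (a * δ i l) ⁻ ≡ 0ℚ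
    vanishes-off-i l l≢i = cong _⁻ (trans (cong (a *_) (δ-offDiag l≢i)) (*-zeroʳ a))

  axis∈DeficitCone : ∀ (i : Fin k) a → DeficitCone (axis i a)
  axis∈DeficitCone i a = bounded (≤-reflexive (deficit-axis i a))

  rest : Fin k → Point k → Point k
  rest i (x , z) = (λ l → x l - x i * δ i l) , z - x i ⁻

  rest-vanishes : ∀ (i : Fin k) p → proj₁ (rest i p) i ≡ 0ℚ
  rest-vanishes i (x , z) = trans (cong (λ d → x i - x i * d) (δ-diag i)) (x-x*1≡0 (x i))
    where
    x-x*1≡0 : ∀ x → x - x * 1ℚ ≡ 0ℚ
    x-x*1≡0 = solve-∀ ℚ-ring

  rest∈DeficitCone : ∀ i {p : Point k} → DeficitCone p → DeficitCone (rest i p)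
  rest∈DeficitCone i {x , z} (bounded deficit≤z) = bounded (p+q≤r⇒p≤r-q (begin
    deficit y + x i ⁻           ≡⟨ Σᶠ-update (λ l → y l ⁻) (λ l → x l ⁻) i agree-off-i ⟩
    deficit x + y i ⁻           ≡⟨ cong (λ q → deficit x + q ⁻) (rest-vanishes i (x , z)) ⟩
    deficit x + 0ℚ              ≡⟨ +-identityʳ (deficit x) ⟩
    deficit x                   ≤⟨ deficit≤z ⟩
    z                           ∎))
    where
    open ≤-Reasoning
    y : Fin _ → ℚ
    y = proj₁ (rest i (x , z))
    x-y*0≡x : ∀ x y → x - y * 0ℚ ≡ x
    x-y*0≡x = solve-∀ ℚ-ring
    agree-off-i : ∀ l → l ≢ i → y l ⁻ ≡ x l ⁻
    agree-off-i l l≢i = cong _⁻ (trans (cong (λ d → x l - x i * d) (δ-offDiag l≢i)) (x-y*0≡x (x l) (x i)))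

  ≈axis+rest : ∀ (i : Fin k) p → p ≈ₚ (axis i (proj₁ p i) +ₚ rest i p)
  ≈axis+rest i (x , z) = (λ l → a≡b+[a-b] (x l) (x i * δ i l)) , a≡b+[a-b] z (x i ⁻)
    where
    a≡b+[a-b] : ∀ a b → a ≡ b + (a - b)
    a≡b+[a-b] = solve-∀ ℚ-ring

  v∈DeficitCone : ∀ (j : Fin k) → 0ℚ ≤ c → DeficitCone (c ·ₚ v j)
  v∈DeficitCone {c = c} j 0≤c = DeficitCone-resp-≈ₚ (axis≈v j 0≤c) (axis∈DeficitCone j c)

  w∈DeficitCone : ∀ (j : Fin k) → 0ℚ ≤ c → DeficitCone (c ·ₚ w j)
  w∈DeficitCone {c = c} j 0≤c = subst (λ a → DeficitCone (a ·ₚ w j)) (⁻¹-involutive c)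
    (DeficitCone-resp-≈ₚ (axis≈w j (neg-antimono-≤ 0≤c)) (axis∈DeficitCone j (- c)))

  extremal-summand : ∀ {C : Point k → Set} {r u u′ : Point k} i →
                     IsExtremalRay C r → C u → C u′ → r ≈ₚ (u +ₚ u′) →
                     proj₁ u i ≢ 0ℚ → proj₁ u′ i ≡ 0ℚ → r ≈ₚ u
  extremal-summand {r = r} {u} {u′} i (_ , _ , indecomposable) Cu Cu′ r≈u+u′ uᵢ≢0 u′ᵢ≡0 =
    ≈ₚ-stable λ r≉u → indecomposable (u , u′ , Cu , Cu′ , r≈u+u′ , λ u∥u′ → r≉u (proportional⇒r≈u u∥u′))
    where
    proportional⇒r≈u : Proportional u u′ → r ≈ₚ u
    proportional⇒r≈u (inj₁ (c , u≈cu′)) =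
      contradiction (trans (proj₁ u≈cu′ i) (trans (cong (c *_) u′ᵢ≡0) (*-zeroʳ c))) uᵢ≢0
    proportional⇒r≈u (inj₂ (c , u′≈cu)) =
      ≈ₚ-trans r≈u+u′ ((λ l → drop (proj₁ u′≈cu l)) , drop (proj₂ u′≈cu))
      where
      c≡0 : c ≡ 0ℚ
      c≡0 = p*q≡0⇒p≡0 uᵢ≢0 (trans (sym (proj₁ u′≈cu i)) u′ᵢ≡0)
      drop : ∀ {a b} → b ≡ c * a → a + b ≡ a
      drop {a} b≡ca = trans (cong (a +_) (trans b≡ca (trans (cong (_* a) c≡0) (*-zeroˡ a)))) (+-identityʳ a)

  multiples-proportional : ∀ {u u′ g : Point k} →
                           ∃[ α ] u ≈ₚ (α ·ₚ g) → ∃[ β ] u′ ≈ₚ (β ·ₚ g) → Proportional u u′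
  multiples-proportional {u = u} (α , u≗αg , s≡αgz) (β , u′≗βg , t≡βgz) with β ≟ℚ 0ℚ
  ... | yes β≡0 = inj₂ (0ℚ , (λ l → vanish (proj₁ u l) (u′≗βg l)) , vanish (proj₂ u) t≡βgz)
    where
    vanish : ∀ x {a b} → a ≡ β * b → a ≡ 0ℚ * x
    vanish x {b = b} a≡βb =
      trans a≡βb (trans (cong (_* b) β≡0) (trans (*-zeroˡ b) (sym (*-zeroˡ x))))
  ... | no β≢0 = inj₁ (α * 1/ β , (λ l → rescale (u≗αg l) (u′≗βg l)) , rescale s≡αgz t≡βgz)
    where
    instance _ = ≢-nonZero β≢0
    regroup : ∀ a i b x → a * i * (b * x) ≡ a * x * (i * b)
    regroup = solve-∀ ℚ-ring
    rescale : ∀ {a a′ x} → a ≡ α * x → a′ ≡ β * x → a ≡ α * 1/ β * a′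
    rescale {a} {a′} {x} a≡αx a′≡βx = begin
      a                      ≡⟨ a≡αx ⟩
      α * x                  ≡⟨ *-identityʳ (α * x) ⟨
      α * x * 1ℚ             ≡⟨ cong (α * x *_) (*-inverseˡ β) ⟨
      α * x * (1/ β * β)     ≡⟨ regroup α (1/ β) β x ⟨
      α * 1/ β * (β * x)     ≡⟨ cong (α * 1/ β *_) a′≡βx ⟨
      α * 1/ β * a′          ∎
      where open ≡-Reasoning

  extremal-if-summands-on-ray : ∀ {C : Point k → Set} {r : Point k} (g : Point k) →
    C r → ¬ (r ≈ₚ 0ₚ) →
    (∀ {u u′} → C u → C u′ → r ≈ₚ (u +ₚ u′) → ∃[ α ] u ≈ₚ (α ·ₚ g)) →
    IsExtremalRay C r
  extremal-if-summands-on-ray g Cr r≉0 summand-on-ray =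
    Cr , r≉0 , λ (u , u′ , Cu , Cu′ , r≈u+u′ , u∦u′) →
      u∦u′ (multiples-proportional (summand-on-ray Cu Cu′ r≈u+u′)
                                   (summand-on-ray Cu′ Cu (≈ₚ-trans r≈u+u′ (+ₚ-comm u u′))))

  vanishing-off⇒≡*δ : ∀ {y : Fin k → ℚ} j → (∀ l → l ≢ j → y l ≡ 0ℚ) → ∀ l → y l ≡ y j * δ j l
  vanishing-off⇒≡*δ {y = y} j y-off-j l with l ≟ j
  ... | yes refl = sym (*-identityʳ (y l))
  ... | no l≢j   = trans (y-off-j l l≢j) (sym (*-zeroʳ (y j)))

  summand-on-v : ∀ {c} {j : Fin k} {u u′ : Point k} → DeficitCone u → DeficitCone u′ →
                 (u +ₚ u′) ≈ₚ (c ·ₚ v j) → u ≈ₚ (proj₁ u j ·ₚ v j)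
  summand-on-v {c = c} {j} {a , s} {b , t} Cu Cu′ (a+b≗cδ , s+t≡c*0) =
    vanishing-off⇒≡*δ j a-off-j , trans s≡0 (sym (*-zeroʳ (a j)))
    where
    s≡0 : s ≡ 0ℚ
    s≡0 = nonNeg+nonNeg≡0⇒≡0 (DeficitCone⇒0≤z Cu) (DeficitCone⇒0≤z Cu′) (trans s+t≡c*0 (*-zeroʳ c))
    a-off-j : ∀ l → l ≢ j → a l ≡ 0ℚ
    a-off-j l l≢j = trans (sym (+-identityˡ (a l))) (trans (cong (_+ a l) (sym s≡0)) s+aₗ≡0)
      where
      open ≡-Reasoning
      s+aₗ≡0 : s + a l ≡ 0ℚ
      s+aₗ≡0 = nonNeg+nonNeg≡0⇒≡0 (DeficitCone⇒0≤z+xᵢ Cu l) (DeficitCone⇒0≤z+xᵢ Cu′ l) (begin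
        s + a l + (t + b l)      ≡⟨ interchange s (a l) t (b l) ⟩
        s + t + (a l + b l)      ≡⟨ cong₂ _+_ s+t≡c*0 (a+b≗cδ l) ⟩
        c * 0ℚ + c * δ j l       ≡⟨ cong (λ d → c * 0ℚ + c * d) (δ-offDiag l≢j) ⟩
        c * 0ℚ + c * 0ℚ          ≡⟨ cong₂ _+_ (*-zeroʳ c) (*-zeroʳ c) ⟩
        0ℚ                       ∎)

  summand-on-w : ∀ {c} {j : Fin k} {u u′ : Point k} → DeficitCone u → DeficitCone u′ →
                 (u +ₚ u′) ≈ₚ (c ·ₚ w j) → u ≈ₚ (proj₂ u ·ₚ w j)
  summand-on-w {c = c} {j} {a , s} {b , t} Cu Cu′ (a+b≗-cδ , s+t≡c*1) =
    (λ l → trans (vanishing-off⇒≡*δ j a-off-j l) (trans (cong (_* δ j l) aⱼ≡-s) (neg-swap s (δ j l)))) ,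
    sym (*-identityʳ s)
    where
    open ≡-Reasoning
    neg-swap : ∀ s d → - s * d ≡ s * - d
    neg-swap = solve-∀ ℚ-ring
    c+c*-1≡0 : ∀ c → c * 1ℚ + c * - 1ℚ ≡ 0ℚ
    c+c*-1≡0 = solve-∀ ℚ-ring
    tight-at-j : s + a j + (t + b j) ≡ 0ℚ
    tight-at-j = begin
      s + a j + (t + b j)      ≡⟨ interchange s (a j) t (b j) ⟩
      s + t + (a j + b j)      ≡⟨ cong₂ _+_ s+t≡c*1 (a+b≗-cδ j) ⟩
      c * 1ℚ + c * - δ j j     ≡⟨ cong (λ d → c * 1ℚ + c * - d) (δ-diag j) ⟩
      c * 1ℚ + c * - 1ℚ        ≡⟨ c+c*-1≡0 c ⟩
      0ℚ                       ∎
    s+aⱼ≡0 : s + a j ≡ 0ℚ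
    s+aⱼ≡0 = nonNeg+nonNeg≡0⇒≡0 (DeficitCone⇒0≤z+xᵢ Cu j) (DeficitCone⇒0≤z+xᵢ Cu′ j) tight-at-j
    aⱼ≡-s : a j ≡ - s
    aⱼ≡-s = inverseʳ-unique s (a j) s+aⱼ≡0
    a-off-j : ∀ l → l ≢ j → a l ≡ 0ℚ
    a-off-j l l≢j = begin
      a l                  ≡⟨ +-identityˡ (a l) ⟨
      0ℚ + a l             ≡⟨ cong (_+ a l) s+aⱼ≡0 ⟨
      s + a j + a l        ≡⟨ nonNeg+nonNeg≡0⇒≡0 (DeficitCone⇒0≤z+xᵢ+xₗ Cu j≢l)
                                                 (DeficitCone⇒0≤z+xᵢ+xₗ Cu′ j≢l) tight-at-j,l ⟩
      0ℚ                   ∎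
      where
      j≢l : j ≢ l
      j≢l = l≢j ∘ sym
      tight-at-j,l : s + a j + a l + (t + b j + b l) ≡ 0ℚ
      tight-at-j,l = begin
        s + a j + a l + (t + b j + b l)      ≡⟨ interchange (s + a j) (a l) (t + b j) (b l) ⟩
        s + a j + (t + b j) + (a l + b l)    ≡⟨ cong₂ _+_ tight-at-j (a+b≗-cδ l) ⟩
        0ℚ + c * - δ j l                     ≡⟨ cong (λ d → 0ℚ + c * - d) (δ-offDiag l≢j) ⟩
        0ℚ + c * 0ℚ                          ≡⟨ cong (0ℚ +_) (*-zeroʳ c) ⟩
        0ℚ                                   ∎

  OnGeneratorRay : Point k → Set
  OnGeneratorRay r = ∃[ j ] ∃[ c ] (0ℚ < c × (r ≈ₚ (c ·ₚ v j) ⊎ r ≈ₚ (c ·ₚ w j)))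

  c·v-extremal : ∀ {r : Point k} {j c} → 0ℚ < c → r ≈ₚ (c ·ₚ v j) → IsExtremalRayOfT k r
  c·v-extremal {r = r} {j} {c} 0<c r≈cv = extremal-if-summands-on-ray (v j)
    (DeficitCone⇒Cone (DeficitCone-resp-≈ₚ (≈ₚ-sym r≈cv) (v∈DeficitCone j (<⇒≤ 0<c))))
    (λ r≈0 → <⇒≢ 0<c (sym (begin
      c              ≡⟨ *-identityʳ c ⟨
      c * 1ℚ         ≡⟨ cong (c *_) (δ-diag j) ⟨
      c * δ j j      ≡⟨ proj₁ r≈cv j ⟨
      proj₁ r j      ≡⟨ proj₁ r≈0 j ⟩
      0ℚ             ∎)))
    (λ {u} {u′} Cu Cu′ r≈u+u′ → proj₁ u j ,
      summand-on-v {c = c} (Cone⇒DeficitCone {p = u} Cu) (Cone⇒DeficitCone {p = u′} Cu′)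
                   (≈ₚ-trans (≈ₚ-sym r≈u+u′) r≈cv))
    where open ≡-Reasoning

  c·w-extremal : ∀ {r : Point k} {j c} → 0ℚ < c → r ≈ₚ (c ·ₚ w j) → IsExtremalRayOfT k r
  c·w-extremal {r = r} {j} {c} 0<c r≈cw = extremal-if-summands-on-ray (w j)
    (DeficitCone⇒Cone (DeficitCone-resp-≈ₚ (≈ₚ-sym r≈cw) (w∈DeficitCone j (<⇒≤ 0<c))))
    (λ r≈0 → <⇒≢ 0<c (sym (trans (sym (*-identityʳ c)) (trans (sym (proj₂ r≈cw)) (proj₂ r≈0)))))
    (λ {u} {u′} Cu Cu′ r≈u+u′ → proj₂ u ,
      summand-on-w {c = c} (Cone⇒DeficitCone {p = u} Cu) (Cone⇒DeficitCone {p = u′} Cu′)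
                   (≈ₚ-trans (≈ₚ-sym r≈u+u′) r≈cw))

  ray⇒extremal : ∀ {r : Point k} → OnGeneratorRay r → IsExtremalRayOfT k r
  ray⇒extremal (j , c , 0<c , inj₁ r≈cv) = c·v-extremal 0<c r≈cv
  ray⇒extremal (j , c , 0<c , inj₂ r≈cw) = c·w-extremal 0<c r≈cw

  extremal⇒axis : ∀ {r : Point k} {i} → IsExtremalRayOfT k r → proj₁ r i ≢ 0ℚ →
                  r ≈ₚ axis i (proj₁ r i)
  extremal⇒axis {r = r} {i} extremal@(Cr , _ , _) rᵢ≢0 =
    extremal-summand i extremal
      (DeficitCone⇒Cone (axis∈DeficitCone i (proj₁ r i)))
      (DeficitCone⇒Cone (rest∈DeficitCone i (Cone⇒DeficitCone {p = r} Cr)))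
      (≈axis+rest i r)
      (rᵢ≢0 ∘ trans (sym (trans (cong (proj₁ r i *_) (δ-diag i)) (*-identityʳ (proj₁ r i)))))
      (rest-vanishes i r)

  v-w-not-proportional : ∀ {z} (j : Fin k) → z ≢ 0ℚ → ¬ Proportional (z ·ₚ v j) (z ·ₚ w j)
  v-w-not-proportional {z = z} j z≢0 (inj₁ (c , zv≈czw)) = z≢0 (begin
    z                       ≡⟨ *-identityʳ z ⟨
    z * 1ℚ                  ≡⟨ cong (z *_) (δ-diag j) ⟨
    z * δ j j               ≡⟨ proj₁ zv≈czw j ⟩
    c * (z * - δ j j)       ≡⟨ cong (_* (z * - δ j j)) c≡0 ⟩
    0ℚ * (z * - δ j j)      ≡⟨ *-zeroˡ (z * - δ j j) ⟩
    0ℚ                      ∎)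
    where
    open ≡-Reasoning
    c≡0 : c ≡ 0ℚ
    c≡0 = p*q≡0⇒p≡0 z≢0 (trans (sym (trans (proj₂ zv≈czw) (cong (c *_) (*-identityʳ z)))) (*-zeroʳ z))
  v-w-not-proportional {z = z} j z≢0 (inj₂ (c , zw≈czv)) =
    z≢0 (trans (sym (*-identityʳ z)) (trans (proj₂ zw≈czv) (trans (cong (c *_) (*-zeroʳ z)) (*-zeroʳ c))))

  extremal⇒∃xᵢ≢0 : ∀ {r : Point (suc k)} → IsExtremalRayOfT (suc k) r → ∃[ i ] proj₁ r i ≢ 0ℚ
  extremal⇒∃xᵢ≢0 {r = x , z} (Cr , r≉0 , indecomposable) with all? (λ i → x i ≟ℚ 0ℚ)
  ... | no ¬x≗0 = ¬∀⟶∃¬ _ _ (λ i → x i ≟ℚ 0ℚ) ¬x≗0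
  ... | yes x≗0 = ⊥-elim (indecomposable
          (z ·ₚ v zero , z ·ₚ w zero ,
           DeficitCone⇒Cone (v∈DeficitCone zero 0≤z) , DeficitCone⇒Cone (w∈DeficitCone zero 0≤z) ,
           ((λ l → trans (x≗0 l) (zv+zw-cancel z (δ zero l))) , z≡z*0+z*1 z) ,
           v-w-not-proportional zero (λ z≡0 → r≉0 (x≗0 , z≡0))))
    where
    0≤z : 0ℚ ≤ z
    0≤z = DeficitCone⇒0≤z (Cone⇒DeficitCone {p = x , z} Cr)
    zv+zw-cancel : ∀ z d → 0ℚ ≡ z * d + z * - d
    zv+zw-cancel = solve-∀ ℚ-ring
    z≡z*0+z*1 : ∀ z → z ≡ z * 0ℚ + z * 1ℚ
    z≡z*0+z*1 = solve-∀ ℚ-ring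

  extremal⇒ray : ∀ {r : Point (suc k)} → IsExtremalRayOfT (suc k) r → OnGeneratorRay r
  extremal⇒ray {r = r} extremal with extremal⇒∃xᵢ≢0 extremal
  ... | i , rᵢ≢0 with <-cmp (proj₁ r i) 0ℚ
  ...   | tri< rᵢ<0 _ _ = i , - proj₁ r i , neg-antimono-< rᵢ<0 ,
                          inj₂ (≈ₚ-trans (extremal⇒axis extremal rᵢ≢0) (axis≈w i (<⇒≤ rᵢ<0)))
  ...   | tri≈ _ rᵢ≡0 _ = contradiction rᵢ≡0 rᵢ≢0
  ...   | tri> _ _ 0<rᵢ = i , proj₁ r i , 0<rᵢ ,
                          inj₁ (≈ₚ-trans (extremal⇒axis extremal rᵢ≢0) (axis≈v i (<⇒≤ 0<rᵢ)))

open import Data.Nat using (ℕ; suc; _≤_)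
open import Data.Rational using (0ℚ; _<_)
open import Data.Product using (_×_; ∃-syntax)
open import Data.Sum using (_⊎_)
open import Function.Bundles using (_⇔_; mk⇔)
open RecessionConeOfT using (extremal⇒ray; ray⇒extremal)

proposition5p5 : (k : ℕ) → 1 ≤ k → (r : Point k) →
    IsExtremalRayOfT k r ⇔
      (∃[ j ] ∃[ c ] (0ℚ < c × (r ≈ₚ (c ·ₚ v j) ⊎ r ≈ₚ (c ·ₚ w j))))
proposition5p5 (suc k) _ r = mk⇔ extremal⇒ray ray⇒extremal
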